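{- Let $\mathcal{T}$ be an infinite family of complete first-order theories in a common language $\Sigma$. If there is no $\Sigma$-sentence $\varphi$ such that $\mathcal{T}_\varphi$ is $e$-minimal, then $\mathcal{T}$ is not $e$-totally transcendental.
   Context: For a $\Sigma$-sentence $\varphi$, $\mathcal{T}_\varphi=\{T\in\mathcal{T}\mid \varphi\in T\}$. An infinite family $\mathcal{F}$ is $e$-minimal if for every $\Sigma$-sentence $\psi$, $\mathcal{F}_\psi$ or $\mathcal{F}_{\neg\psi}$ is finite. Sentences are pairwise inconsistent if the conjunction of any two distinct ones has no model. Rank ${\rm RS}$: ${\rm RS}(\emptyset)=-1$; ${\rm RS}(\mathcal{T})=0$ for finite nonempty $\mathcal{T}$; ${\rm RS}(\mathcal{T})\geq 1$ for infinite $\mathcal{T}$; for $\alpha=\beta+1$, ${\rm RS}(\mathcal{T})\geq\alpha$ iff there are pairwise inconsistent $\Sigma$-sentences $\varphi_n$, $n\in\omega$, with ${\rm RS}(\mathcal{T}_{\varphi_n})\geq\beta$ for all $n$; for limit $\alpha$, ${\rm RS}(\mathcal{T})\geq\alpha$ iff ${\rm RS}(\mathcal{T})\geq\beta$ for all $\beta<\alpha$; ${\rm RS}(\mathcal{T})=\infty$ if ${\rm RS}(\mathcal{T})\geq\alpha$ for all ordinals $\alpha$. $\mathcal{T}$ is $e$-totally transcendental if ${\rm RS}(\mathcal{T})$ is an ordinal. -}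

module Defs where

open import Level using (0ℓ) renaming (suc to lsuc)
open import Data.Nat using (ℕ)
open import Data.Fin using (Fin; zero; suc)
open import Data.Vec using (Vec; []; _∷_)
open import Data.List using (List)
open import Data.List.Relation.Unary.Any using (Any)
open import Data.Product using (Σ; Σ-syntax; ∃; _×_; _,_)
open import Data.Sum using (_⊎_)
open import Data.Empty using (⊥)
open import Relation.Nullary using (¬_)
open import Relation.Binary.PropositionalEquality using (_≡_; _≢_)
open import Function.Bundles using (_⇔_)

record Signature : Set₁ where
  field
    FunSym   : Set
    funArity : FunSym → ℕ
    RelSym   : Set
    relArity : RelSym → ℕ

module _ (L : Signature) where
  open Signature L

  -- terms with n free variables (de Bruijn)
  data Term (n : ℕ) : Set where
    var : Fin n → Term n
    app : (f : FunSym) → Vec (Term n) (funArity f) → Term n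

  data Formula (n : ℕ) : Set where
    ⊥'   : Formula n
    _≐_  : Term n → Term n → Formula n
    rel  : (r : RelSym) → Vec (Term n) (relArity r) → Formula n
    ¬'_  : Formula n → Formula n
    _∧'_ : Formula n → Formula n → Formula n
    _∨'_ : Formula n → Formula n → Formula n
    _⇒'_ : Formula n → Formula n → Formula n
    ∀'   : Formula (ℕ.suc n) → Formula n
    ∃'   : Formula (ℕ.suc n) → Formula n

  Sentence : Set
  Sentence = Formula 0

  -- Σ-structures (nonempty domain; equality interpreted as identity)
  record Structure : Set₁ where
    field
      Carrier : Set
      elem    : Carrier
      funI    : (f : FunSym) → Vec Carrier (funArity f) → Carrier
      relI    : (r : RelSym) → Vec Carrier (relArity r) → Set

  module _ (M : Structure) where
    open Structure M

    extend : ∀ {n} → (Fin n → Carrier) → Carrier → Fin (ℕ.suc n) → Carrier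
    extend ρ a zero    = a
    extend ρ a (suc i) = ρ i

    mutual
      evalTerm : ∀ {n} → (Fin n → Carrier) → Term n → Carrier
      evalTerm ρ (var i)    = ρ i
      evalTerm ρ (app f ts) = funI f (evalTerms ρ ts)

      evalTerms : ∀ {n k} → (Fin n → Carrier) → Vec (Term n) k → Vec Carrier k
      evalTerms ρ []       = []
      evalTerms ρ (t ∷ ts) = evalTerm ρ t ∷ evalTerms ρ ts

    -- satisfaction (read classically; see the excluded-middle hypothesis)
    Sat : ∀ {n} → (Fin n → Carrier) → Formula n → Set
    Sat ρ ⊥'         = ⊥
    Sat ρ (s ≐ t)    = evalTerm ρ s ≡ evalTerm ρ t
    Sat ρ (rel r ts) = relI r (evalTerms ρ ts)
    Sat ρ (¬' φ)     = ¬ Sat ρ φ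
    Sat ρ (φ ∧' ψ)   = Sat ρ φ × Sat ρ ψ
    Sat ρ (φ ∨' ψ)   = Sat ρ φ ⊎ Sat ρ ψ
    Sat ρ (φ ⇒' ψ)   = Sat ρ φ → Sat ρ ψ
    Sat ρ (∀' φ)     = (a : Carrier) → Sat (extend ρ a) φ
    Sat ρ (∃' φ)     = Σ[ a ∈ Carrier ] Sat (extend ρ a) φ

    noVars : Fin 0 → Carrier
    noVars ()

    _⊨_ : Sentence → Set
    _⊨_ φ = Sat noVars φ

  Satisfiable : Sentence → Set₁
  Satisfiable φ = Σ[ M ∈ Structure ] _⊨_ M φ

  Theory : Set₁
  Theory = Sentence → Set

  Complete : Theory → Set₁
  Complete T = (Σ[ M ∈ Structure ] (∀ φ → T φ → _⊨_ M φ))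
             × (∀ φ → T φ ⊎ T (¬' φ))

  _≈T_ : Theory → Theory → Set
  T ≈T T' = ∀ φ → T φ ⇔ T' φ

  Family : Set₂
  Family = Theory → Set₁

  _restrict_ : Family → Sentence → Family
  (𝒯 restrict φ) T = 𝒯 T × T φ

  Nonempty : Family → Set₁
  Nonempty 𝒯 = Σ[ T ∈ Theory ] 𝒯 T

  Finite : Family → Set₁
  Finite 𝒯 = Σ[ Ts ∈ List Theory ] (∀ T → 𝒯 T → Any (T ≈T_) Ts)

  Infinite : Family → Set₁
  Infinite 𝒯 = ¬ Finite 𝒯

  EMinimal : Family → Set₁
  EMinimal 𝓕 = Infinite 𝓕 × (∀ ψ → Finite (𝓕 restrict ψ) ⊎ Finite (𝓕 restrict (¬' ψ)))

  PairwiseInconsistent : (ℕ → Sentence) → Set₁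
  PairwiseInconsistent φs = ∀ m n → m ≢ n → ¬ Satisfiable (φs m ∧' φs n)

-- Ordinals (Brouwer-style trees with arbitrary, inhabited index sets;
-- lim a f denotes the supremum of the family f)

data Ord : Set₁ where
  zero : Ord
  suc  : Ord → Ord
  lim  : {A : Set} → A → (A → Ord) → Ord

RS≥ : (L : Signature) → Family L → Ord → Set₁
RS≥ L 𝒯 zero        = Nonempty L 𝒯
RS≥ L 𝒯 (suc zero)  = Infinite L 𝒯
RS≥ L 𝒯 (suc β)     = Σ[ φs ∈ (ℕ → Sentence L) ]
                        (PairwiseInconsistent L φs × (∀ n → RS≥ L (_restrict_ L 𝒯 (φs n)) β))
RS≥ L 𝒯 (lim a f)   = ∀ b → RS≥ L 𝒯 (f b)

-- RS(𝒯) is an ordinal: RS(𝒯) = α for some α, i.e. RS(𝒯) ≥ α and not ≥ α+1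
ETotallyTranscendental : (L : Signature) → Family L → Set₁
ETotallyTranscendental L 𝒯 = Σ[ α ∈ Ord ] (RS≥ L 𝒯 α × ¬ RS≥ L 𝒯 (suc α))

-- If no 𝒯_φ is e-minimal, then every infinite 𝒯_θ is split by some ψ into two
-- infinite parts 𝒯_{θ∧ψ} and 𝒯_{θ∧¬ψ}. Splitting the part θ∧ψ again and again
-- yields θ = θ₀, θₙ₊₁ = θₙ ∧ ψₙ, and the discarded pieces φₙ = θₙ ∧ ¬ψₙ are
-- pairwise inconsistent sentences with 𝒯_{φₙ} infinite. By induction on α,
-- RS(𝒯_θ) ≥ α for every infinite 𝒯_θ and every α, so RS(𝒯) ≥ α + 1 for all α.
module Submission where

open import Defs
open import Level using (0ℓ) renaming (suc to lsuc)
open import Axiom.ExcludedMiddle using (ExcludedMiddle)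
open import Data.Product using (Σ-syntax; _,_; proj₁; proj₂; _×_; map₁)
open import Relation.Nullary using (¬_; yes; no; contradiction)
open import Data.Sum using (_⊎_; inj₁; inj₂)
open import Data.Empty using (⊥-elim)
open import Data.Nat using (ℕ; zero; suc; _<_; _≤′_; ≤′-refl; ≤′-step)
open import Data.Nat.Properties using (<-cmp; ≤⇒≤′; z≤′n)
open import Data.List using ([])
open import Relation.Binary using (tri<; tri≈; tri>)
open import Relation.Unary using (_⊆_)

module _ {L : Signature} where

  infinite-mono : {𝒜 ℬ : Family L} → 𝒜 ⊆ ℬ → Infinite L 𝒜 → Infinite L ℬ
  infinite-mono 𝒜⊆ℬ ∞𝒜 (Ts , ℬ⊆Ts) = ∞𝒜 (Ts , λ T T∈𝒜 → ℬ⊆Ts T (𝒜⊆ℬ T∈𝒜))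

  infinite⇒nonempty : ExcludedMiddle (lsuc 0ℓ) → {𝒜 : Family L} →
                      Infinite L 𝒜 → Nonempty L 𝒜
  infinite⇒nonempty em {𝒜} ∞𝒜 with em {Nonempty L 𝒜}
  ... | yes ne = ne
  ... | no ¬ne = ⊥-elim (∞𝒜 ([] , λ T T∈𝒜 → contradiction (T , T∈𝒜) ¬ne))

  finite⊎finite : ExcludedMiddle (lsuc 0ℓ) → {𝒜 ℬ : Family L} →
                  ¬ (Infinite L 𝒜 × Infinite L ℬ) → Finite L 𝒜 ⊎ Finite L ℬ
  finite⊎finite em {𝒜} {ℬ} ¬both with em {Finite L 𝒜} | em {Finite L ℬ}
  ... | yes fin𝒜 | _        = inj₁ fin𝒜
  ... | no _     | yes finℬ = inj₂ finℬ
  ... | no ∞𝒜    | no ∞ℬ    = ⊥-elim (¬both (∞𝒜 , ∞ℬ))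

  restrict-mono : {𝒜 ℬ : Family L} {φ : Sentence L} →
                  𝒜 ⊆ ℬ → _restrict_ L 𝒜 φ ⊆ _restrict_ L ℬ φ
  restrict-mono 𝒜⊆ℬ = map₁ 𝒜⊆ℬ

  RS≥-mono : {𝒜 ℬ : Family L} → 𝒜 ⊆ ℬ → ∀ α → RS≥ L 𝒜 α → RS≥ L ℬ α
  RS≥-mono 𝒜⊆ℬ zero       (T , T∈𝒜) = T , 𝒜⊆ℬ T∈𝒜
  RS≥-mono 𝒜⊆ℬ (suc zero) ∞𝒜        = infinite-mono 𝒜⊆ℬ ∞𝒜
  RS≥-mono {𝒜} {ℬ} 𝒜⊆ℬ (suc β@(suc _))   (φs , pi , rs) =
    φs , pi , λ n → RS≥-mono (restrict-mono {𝒜} {ℬ} {φs n} 𝒜⊆ℬ) β (rs n)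
  RS≥-mono {𝒜} {ℬ} 𝒜⊆ℬ (suc β@(lim _ _)) (φs , pi , rs) =
    φs , pi , λ n → RS≥-mono (restrict-mono {𝒜} {ℬ} {φs n} 𝒜⊆ℬ) β (rs n)
  RS≥-mono 𝒜⊆ℬ (lim a f) rs = λ b → RS≥-mono 𝒜⊆ℬ (f b) (rs b)

  -- RS ≥ 1 is defined as infinitude rather than by a sequence of sentences.
  RS≥-suc-intro : {𝒜 : Family L} → ∀ β → Infinite L 𝒜 →
                  Σ[ φs ∈ (ℕ → Sentence L) ]
                    (PairwiseInconsistent L φs × (∀ n → RS≥ L (_restrict_ L 𝒜 (φs n)) β)) →
                  RS≥ L 𝒜 (suc β)
  RS≥-suc-intro zero      ∞𝒜 _   = ∞𝒜
  RS≥-suc-intro (suc _)   _  seq = seq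
  RS≥-suc-intro (lim _ _) _  seq = seq

  pairwiseInconsistent-from-< : (φs : ℕ → Sentence L) →
    (∀ m n → m < n → ¬ Satisfiable L (φs m ∧' φs n)) → PairwiseInconsistent L φs
  pairwiseInconsistent-from-< φs incons m n m≢n (M , ⊨φm , ⊨φn) with <-cmp m n
  ... | tri< m<n _ _ = incons m n m<n (M , ⊨φm , ⊨φn)
  ... | tri≈ _ m≡n _ = m≢n m≡n
  ... | tri> _ _ n<m = incons n m n<m (M , ⊨φn , ⊨φm)

  complete-closed-⊨ : {T : Theory L} {φ : Sentence L} → Complete L T →
    (∀ M → (∀ ψ → T ψ → _⊨_ L M ψ) → _⊨_ L M φ) → T φ
  complete-closed-⊨ {φ = φ} ((M , M⊨T) , decides) T⊨φ with decides φ
  ... | inj₁ φ∈T  = φ∈T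
  ... | inj₂ ¬φ∈T = ⊥-elim (M⊨T _ ¬φ∈T (T⊨φ M M⊨T))

  restrict-∧ : {𝒜 : Family L} {θ ψ : Sentence L} → (∀ T → 𝒜 T → Complete L T) →
               _restrict_ L (_restrict_ L 𝒜 θ) ψ ⊆ _restrict_ L 𝒜 (θ ∧' ψ)
  restrict-∧ {θ = θ} {ψ} complete ((T∈𝒜 , θ∈T) , ψ∈T) =
    T∈𝒜 , complete-closed-⊨ (complete _ T∈𝒜) (λ M M⊨T → M⊨T θ θ∈T , M⊨T ψ ψ∈T)

module _ (em : ExcludedMiddle (lsuc 0ℓ)) {L : Signature} (𝒯 : Family L)
         (complete : ∀ T → 𝒯 T → Complete L T)
         (no-e-minimal : ¬ (Σ[ φ ∈ Sentence L ] EMinimal L (_restrict_ L 𝒯 φ))) where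

  private
    _∣_ : Family L → Sentence L → Family L
    _∣_ = _restrict_ L

  Wide : Sentence L → Set₁
  Wide θ = Infinite L (𝒯 ∣ θ)

  WideSentence : Set₁
  WideSentence = Σ[ θ ∈ Sentence L ] Wide θ

  Splitting : Sentence L → Set₁
  Splitting θ = Σ[ ψ ∈ Sentence L ] (Wide (θ ∧' ψ) × Wide (θ ∧' (¬' ψ)))

  wide-splitting : ∀ θ → Wide θ → Splitting θ
  wide-splitting θ wide with em {Splitting θ}
  ... | yes splitting = splitting
  ... | no ¬splitting = ⊥-elim (no-e-minimal (θ , wide , λ ψ → finite⊎finite em
          λ (∞ψ , ∞¬ψ) → ¬splitting (ψ , infinite-mono (restrict-∧ complete) ∞ψ
                                          , infinite-mono (restrict-∧ complete) ∞¬ψ)))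

  splitter : WideSentence → Sentence L
  splitter (θ , wide) = proj₁ (wide-splitting θ wide)

  kept discarded : WideSentence → WideSentence
  kept      (θ , wide) = θ ∧' splitter (θ , wide)      , proj₁ (proj₂ (wide-splitting θ wide))
  discarded (θ , wide) = θ ∧' (¬' splitter (θ , wide)) , proj₂ (proj₂ (wide-splitting θ wide))

  module Splitting-sequence (start : WideSentence) where

    stage : ℕ → WideSentence
    stage zero    = start
    stage (suc n) = kept (stage n)

    φs : ℕ → Sentence L
    φs n = proj₁ (discarded (stage n))

    stage-antitone : ∀ M {m n} → m ≤′ n →
                     _⊨_ L M (proj₁ (stage n)) → _⊨_ L M (proj₁ (stage m))
    stage-antitone M ≤′-refl       ⊨stage = ⊨stage
    stage-antitone M (≤′-step m≤n) ⊨stage = stage-antitone M m≤n (proj₁ ⊨stage)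

    -- φₘ asserts ¬ψₘ, while φₙ for n > m implies θₘ₊₁ = θₘ ∧ ψₘ.
    φs-pairwiseInconsistent : PairwiseInconsistent L φs
    φs-pairwiseInconsistent = pairwiseInconsistent-from-< φs λ m n m<n (M , ⊨φm , ⊨φn) →
      proj₂ ⊨φm (proj₂ (stage-antitone M (≤⇒≤′ m<n) (proj₁ ⊨φn)))

    φs-restrict : ∀ n → 𝒯 ∣ φs n ⊆ (𝒯 ∣ proj₁ start) ∣ φs n
    φs-restrict n (T∈𝒯 , φn∈T) =
      (T∈𝒯 , complete-closed-⊨ (complete _ T∈𝒯)
               λ M M⊨T → stage-antitone M (z≤′n {n}) (proj₁ (M⊨T (φs n) φn∈T)))
      , φn∈T

  wide⇒RS≥ : ∀ α θ → Wide θ → RS≥ L (𝒯 ∣ θ) α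
  wide⇒RS≥ zero      θ wide = infinite⇒nonempty em wide
  wide⇒RS≥ (suc β)   θ wide = RS≥-suc-intro β wide
    (φs , φs-pairwiseInconsistent , λ n →
      RS≥-mono (φs-restrict n) β (wide⇒RS≥ β (φs n) (proj₂ (discarded (stage n)))))
    where open Splitting-sequence (θ , wide)
  wide⇒RS≥ (lim a f) θ wide = λ b → wide⇒RS≥ (f b) θ wide

proposition3p2 : ExcludedMiddle (lsuc 0ℓ) →
    (L : Signature) (𝒯 : Family L) →
    (∀ T → 𝒯 T → Complete L T) →
    Infinite L 𝒯 →
    ¬ (Σ[ φ ∈ Sentence L ] EMinimal L (_restrict_ L 𝒯 φ)) →
    ¬ ETotallyTranscendental L 𝒯
proposition3p2 em L 𝒯 complete ∞𝒯 no-e-minimal (α , _ , ¬RS≥α+1) =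
  ¬RS≥α+1 (RS≥-mono proj₁ (suc α) (wide⇒RS≥ em 𝒯 complete no-e-minimal (suc α) ⊤ wide-⊤))
  where
  ⊤ : Sentence L
  ⊤ = ¬' ⊥'

  wide-⊤ : Wide em 𝒯 complete no-e-minimal ⊤
  wide-⊤ = infinite-mono (λ {T} T∈𝒯 → T∈𝒯 , complete-closed-⊨ (complete T T∈𝒯) λ _ _ ()) ∞𝒯
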